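{- Let $(!,\delta,\varepsilon,\Delta,\mathsf e,\mathsf m,\mathsf m_K)$ be a monoidal coalgebra modality on an additive symmetric monoidal category $(\mathbb X,\otimes,K)$, and for each object $A$ let $\nabla_A=!\big(\rho_A\circ(\varepsilon_A\otimes\mathsf e_A)+\ell_A\circ(\mathsf e_A\otimes\varepsilon_A)\big)\circ\mathsf m_{!A,!A}\circ(\delta_A\otimes\delta_A)$ and $\mathsf u_A=!(0_{K,A})\circ\mathsf m_K$. Then there exists a natural transformation $\mathsf S_A:!A\to!A$ such that for each object $A$, $(!A,\nabla_A,\mathsf u_A,\Delta_A,\mathsf e_A,\mathsf S_A)$ is a cocommutative Hopf monoid, if and only if $(\mathbb X,\otimes,K)$ is enriched over abelian groups (i.e. every map has an additive inverse).
   Context: Composition is written $g\circ f$; $(\mathbb X,\otimes,K)$ is symmetric monoidal with unitors $\ell_A:K\otimes A\to A$, $\rho_A:A\otimes K\to A$ and interchange iso $\tau_{A,B,C,D}:(A\otimes B)\otimes(C\otimes D)\to(A\otimes C)\otimes(B\otimes D)$. Additive symmetric monoidal category: hom-sets are commutative monoids (sum $+$, zero $0$), composition and $\otimes$ preserve sums and zeros in each argument. Monoidal coalgebra modality: comonad $(!,\delta,\varepsilon)$ with lax symmetric monoidal structure $\mathsf m_{A,B}:!A\otimes!B\to!(A\otimes B)$, $\mathsf m_K:K\to!K$ making $\delta,\varepsilon$ monoidal, and natural $\Delta_A:!A\to!A\otimes!A$, $\mathsf e_A:!A\to K$ making each $!A$ a cocommutative comonoid with $\delta_A$ a comonoid morphism,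 such that $\Delta_{A\otimes B}\circ\mathsf m_{A,B}=(\mathsf m_{A,B}\otimes\mathsf m_{A,B})\circ\tau\circ(\Delta_A\otimes\Delta_B)$, $\mathsf e_{A\otimes B}\circ\mathsf m_{A,B}=\ell_K\circ(\mathsf e_A\otimes\mathsf e_B)$, $\Delta_K\circ\mathsf m_K=(\mathsf m_K\otimes\mathsf m_K)\circ\ell_K^{ -1}$, $\mathsf e_K\circ\mathsf m_K=1_K$, $!(\Delta_A)\circ\delta_A=\mathsf m_{!A,!A}\circ(\delta_A\otimes\delta_A)\circ\Delta_A$, $!(\mathsf e_A)\circ\delta_A=\mathsf m_K\circ\mathsf e_A$. A Hopf monoid is a bimonoid $(H,\nabla,\mathsf u,\Delta,\mathsf e)$ with $\mathsf S:H\to H$ such that $\nabla\circ(1\otimes\mathsf S)\circ\Delta=\mathsf u\circ\mathsf e=\nabla\circ(\mathsf S\otimes1)\circ\Delta$. -}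

module Defs where

open import Level using (Level; _⊔_) renaming (suc to lsuc)
open import Relation.Binary using (Rel; IsEquivalence)
open import Algebra.Structures using (IsCommutativeMonoid)
open import Data.Product using (Σ; _×_; ∃)

record Category (o h e : Level) : Set (lsuc (o ⊔ h ⊔ e)) where
  infixr 9 _∘_
  infix 4 _≈_
  field
    Obj     : Set o
    Hom     : Obj → Obj → Set h
    _≈_     : ∀ {A B} → Rel (Hom A B) e
    ≈-equiv : ∀ {A B} → IsEquivalence (_≈_ {A} {B})
    id      : ∀ {A} → Hom A A
    _∘_     : ∀ {A B C} → Hom B C → Hom A B → Hom A C
    ∘-resp  : ∀ {A B C} {f f′ : Hom B C} {g g′ : Hom A B} →
              f ≈ f′ → g ≈ g′ → f ∘ g ≈ f′ ∘ g′
    assoc   : ∀ {A B C D} {f : Hom C D} {g : Hom B C} {k : Hom A B} →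
              (f ∘ g) ∘ k ≈ f ∘ (g ∘ k)
    identityˡ : ∀ {A B} {f : Hom A B} → id ∘ f ≈ f
    identityʳ : ∀ {A B} {f : Hom A B} → f ∘ id ≈ f

record SymmetricMonoidalCategory (o h e : Level) : Set (lsuc (o ⊔ h ⊔ e)) where
  field
    cat : Category o h e
  open Category cat public
  infixr 10 _⊗₀_ _⊗₁_
  field
    _⊗₀_ : Obj → Obj → Obj
    _⊗₁_ : ∀ {A B C D} → Hom A B → Hom C D → Hom (A ⊗₀ C) (B ⊗₀ D)
    ⊗-resp : ∀ {A B C D} {f f′ : Hom A B} {g g′ : Hom C D} →
             f ≈ f′ → g ≈ g′ → f ⊗₁ g ≈ f′ ⊗₁ g′
    ⊗-id : ∀ {A B} → id {A} ⊗₁ id {B} ≈ id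
    ⊗-∘  : ∀ {A B C D E F} {f : Hom B C} {g : Hom A B} {k : Hom E F} {l : Hom D E} →
           (f ∘ g) ⊗₁ (k ∘ l) ≈ (f ⊗₁ k) ∘ (g ⊗₁ l)
    K : Obj
    α    : ∀ {A B C} → Hom ((A ⊗₀ B) ⊗₀ C) (A ⊗₀ (B ⊗₀ C))
    α⁻¹  : ∀ {A B C} → Hom (A ⊗₀ (B ⊗₀ C)) ((A ⊗₀ B) ⊗₀ C)
    α-isoˡ : ∀ {A B C} → α⁻¹ ∘ α {A} {B} {C} ≈ id
    α-isoʳ : ∀ {A B C} → α {A} {B} {C} ∘ α⁻¹ ≈ id
    α-nat : ∀ {A A′ B B′ C C′} {f : Hom A A′} {g : Hom B B′} {k : Hom C C′} →
            α ∘ ((f ⊗₁ g) ⊗₁ k) ≈ (f ⊗₁ (g ⊗₁ k)) ∘ α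
    ℓ    : ∀ {A} → Hom (K ⊗₀ A) A
    ℓ⁻¹  : ∀ {A} → Hom A (K ⊗₀ A)
    ℓ-isoˡ : ∀ {A} → ℓ⁻¹ ∘ ℓ {A} ≈ id
    ℓ-isoʳ : ∀ {A} → ℓ {A} ∘ ℓ⁻¹ ≈ id
    ℓ-nat : ∀ {A B} {f : Hom A B} → f ∘ ℓ ≈ ℓ ∘ (id ⊗₁ f)
    ρ    : ∀ {A} → Hom (A ⊗₀ K) A
    ρ⁻¹  : ∀ {A} → Hom A (A ⊗₀ K)
    ρ-isoˡ : ∀ {A} → ρ⁻¹ ∘ ρ {A} ≈ id
    ρ-isoʳ : ∀ {A} → ρ {A} ∘ ρ⁻¹ ≈ id
    ρ-nat : ∀ {A B} {f : Hom A B} → f ∘ ρ ≈ ρ ∘ (f ⊗₁ id)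
    σ : ∀ {A B} → Hom (A ⊗₀ B) (B ⊗₀ A)
    σ-nat : ∀ {A A′ B B′} {f : Hom A A′} {g : Hom B B′} →
            σ ∘ (f ⊗₁ g) ≈ (g ⊗₁ f) ∘ σ
    σ-invol : ∀ {A B} → σ {B} {A} ∘ σ {A} {B} ≈ id
    triangle : ∀ {A B} → (id {A} ⊗₁ ℓ {B}) ∘ α ≈ ρ ⊗₁ id
    pentagon : ∀ {A B C D} →
               (id {A} ⊗₁ α {B} {C} {D}) ∘ (α ∘ (α ⊗₁ id)) ≈ α ∘ α
    hexagon  : ∀ {A B C} →
               α {B} {C} {A} ∘ (σ ∘ α) ≈ (id ⊗₁ σ) ∘ (α ∘ (σ {A} {B} ⊗₁ id {C}))

  τ : ∀ {A B C D} → Hom ((A ⊗₀ B) ⊗₀ (C ⊗₀ D)) ((A ⊗₀ C) ⊗₀ (B ⊗₀ D))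
  τ {A} {B} {C} {D} =
    α⁻¹ ∘ ((id ⊗₁ α) ∘ ((id ⊗₁ (σ {B} {C} ⊗₁ id {D})) ∘ ((id ⊗₁ α⁻¹) ∘ α)))

record AdditiveSymmetricMonoidalCategory (o h e : Level) : Set (lsuc (o ⊔ h ⊔ e)) where
  field
    smc : SymmetricMonoidalCategory o h e
  open SymmetricMonoidalCategory smc public
  infixl 6 _+_
  field
    _+_ : ∀ {A B} → Hom A B → Hom A B → Hom A B
    0h  : ∀ {A B} → Hom A B
    +-isCommutativeMonoid : ∀ {A B} → IsCommutativeMonoid (_≈_ {A} {B}) _+_ 0h
    ∘-distribˡ : ∀ {A B C} {k : Hom B C} {f g : Hom A B} → k ∘ (f + g) ≈ (k ∘ f) + (k ∘ g)
    ∘-distribʳ : ∀ {A B C} {f g : Hom B C} {k : Hom A B} → (f + g) ∘ k ≈ (f ∘ k) + (g ∘ k)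
    ∘-zeroˡ : ∀ {A B C} {f : Hom A B} → 0h {B} {C} ∘ f ≈ 0h
    ∘-zeroʳ : ∀ {A B C} {f : Hom B C} → f ∘ 0h {A} {B} ≈ 0h
    ⊗-distribˡ : ∀ {A B C D} {k : Hom A B} {f g : Hom C D} → k ⊗₁ (f + g) ≈ (k ⊗₁ f) + (k ⊗₁ g)
    ⊗-distribʳ : ∀ {A B C D} {f g : Hom A B} {k : Hom C D} → (f + g) ⊗₁ k ≈ (f ⊗₁ k) + (g ⊗₁ k)
    ⊗-zeroˡ : ∀ {A B C D} {f : Hom C D} → 0h {A} {B} ⊗₁ f ≈ 0h
    ⊗-zeroʳ : ∀ {A B C D} {f : Hom A B} → f ⊗₁ 0h {C} {D} ≈ 0h

AbelianGroupEnriched : ∀ {o h e} → AdditiveSymmetricMonoidalCategory o h e → Set (o ⊔ h ⊔ e)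
AbelianGroupEnriched 𝕏 =
  ∀ {A B} (f : Hom A B) → Σ (Hom A B) (λ g → (f + g) ≈ 0h)
  where open AdditiveSymmetricMonoidalCategory 𝕏

record MonoidalCoalgebraModality {o h e} (𝕊 : SymmetricMonoidalCategory o h e)
       : Set (o ⊔ h ⊔ e) where
  open SymmetricMonoidalCategory 𝕊
  field
    !₀ : Obj → Obj
    !₁ : ∀ {A B} → Hom A B → Hom (!₀ A) (!₀ B)
    !-resp : ∀ {A B} {f g : Hom A B} → f ≈ g → !₁ f ≈ !₁ g
    !-id : ∀ {A} → !₁ (id {A}) ≈ id
    !-∘  : ∀ {A B C} {f : Hom B C} {g : Hom A B} → !₁ (f ∘ g) ≈ !₁ f ∘ !₁ g
    δ : ∀ {A} → Hom (!₀ A) (!₀ (!₀ A))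
    ε : ∀ {A} → Hom (!₀ A) A
    δ-nat : ∀ {A B} {f : Hom A B} → !₁ (!₁ f) ∘ δ ≈ δ ∘ !₁ f
    ε-nat : ∀ {A B} {f : Hom A B} → f ∘ ε ≈ ε ∘ !₁ f
    comonad-idˡ : ∀ {A} → ε { !₀ A } ∘ δ {A} ≈ id
    comonad-idʳ : ∀ {A} → !₁ (ε {A}) ∘ δ {A} ≈ id
    comonad-assoc : ∀ {A} → δ { !₀ A } ∘ δ {A} ≈ !₁ (δ {A}) ∘ δ {A}
    m  : ∀ {A B} → Hom (!₀ A ⊗₀ !₀ B) (!₀ (A ⊗₀ B))
    mK : Hom K (!₀ K)
    m-nat : ∀ {A A′ B B′} {f : Hom A A′} {g : Hom B B′} →
            !₁ (f ⊗₁ g) ∘ m ≈ m ∘ (!₁ f ⊗₁ !₁ g)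
    m-assoc : ∀ {A B C} →
              m {A} {B ⊗₀ C} ∘ ((id ⊗₁ m {B} {C}) ∘ α)
              ≈ !₁ α ∘ (m {A ⊗₀ B} {C} ∘ (m {A} {B} ⊗₁ id))
    m-unitˡ : ∀ {A} → !₁ (ℓ {A}) ∘ (m ∘ (mK ⊗₁ id)) ≈ ℓ
    m-unitʳ : ∀ {A} → !₁ (ρ {A}) ∘ (m ∘ (id ⊗₁ mK)) ≈ ρ
    m-sym : ∀ {A B} → !₁ (σ {A} {B}) ∘ m ≈ m ∘ σ
    δ-m  : ∀ {A B} → δ {A ⊗₀ B} ∘ m ≈ !₁ m ∘ (m ∘ (δ ⊗₁ δ))
    δ-mK : δ {K} ∘ mK ≈ !₁ mK ∘ mK
    ε-m  : ∀ {A B} → ε {A ⊗₀ B} ∘ m ≈ ε ⊗₁ ε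
    ε-mK : ε {K} ∘ mK ≈ id
    Δ : ∀ {A} → Hom (!₀ A) (!₀ A ⊗₀ !₀ A)
    𝖾 : ∀ {A} → Hom (!₀ A) K
    Δ-nat : ∀ {A B} {f : Hom A B} → (!₁ f ⊗₁ !₁ f) ∘ Δ ≈ Δ ∘ !₁ f
    𝖾-nat : ∀ {A B} {f : Hom A B} → 𝖾 ∘ !₁ f ≈ 𝖾
    Δ-coassoc : ∀ {A} → α ∘ ((Δ ⊗₁ id) ∘ Δ {A}) ≈ (id ⊗₁ Δ) ∘ Δ
    Δ-counitˡ : ∀ {A} → ℓ ∘ ((𝖾 ⊗₁ id) ∘ Δ {A}) ≈ id
    Δ-counitʳ : ∀ {A} → ρ ∘ ((id ⊗₁ 𝖾) ∘ Δ {A}) ≈ id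
    Δ-cocomm  : ∀ {A} → σ ∘ Δ {A} ≈ Δ
    δ-Δ : ∀ {A} → Δ { !₀ A } ∘ δ ≈ (δ ⊗₁ δ) ∘ Δ
    δ-𝖾 : ∀ {A} → 𝖾 { !₀ A } ∘ δ ≈ 𝖾
    Δ-m  : ∀ {A B} → Δ {A ⊗₀ B} ∘ m ≈ (m ⊗₁ m) ∘ (τ ∘ (Δ ⊗₁ Δ))
    𝖾-m  : ∀ {A B} → 𝖾 {A ⊗₀ B} ∘ m ≈ ℓ ∘ (𝖾 ⊗₁ 𝖾)
    Δ-mK : Δ {K} ∘ mK ≈ (mK ⊗₁ mK) ∘ ℓ⁻¹
    𝖾-mK : 𝖾 {K} ∘ mK ≈ id
    !Δ-δ : ∀ {A} → !₁ (Δ {A}) ∘ δ ≈ m ∘ ((δ ⊗₁ δ) ∘ Δ)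
    !𝖾-δ : ∀ {A} → !₁ (𝖾 {A}) ∘ δ ≈ mK ∘ 𝖾

record IsCocommutativeHopfMonoid {o h e} (𝕊 : SymmetricMonoidalCategory o h e)
       (H : SymmetricMonoidalCategory.Obj 𝕊)
       (∇ : SymmetricMonoidalCategory.Hom 𝕊 (SymmetricMonoidalCategory._⊗₀_ 𝕊 H H) H)
       (u : SymmetricMonoidalCategory.Hom 𝕊 (SymmetricMonoidalCategory.K 𝕊) H)
       (Δ : SymmetricMonoidalCategory.Hom 𝕊 H (SymmetricMonoidalCategory._⊗₀_ 𝕊 H H))
       (ε : SymmetricMonoidalCategory.Hom 𝕊 H (SymmetricMonoidalCategory.K 𝕊))
       (S : SymmetricMonoidalCategory.Hom 𝕊 H H) : Set e where
  open SymmetricMonoidalCategory 𝕊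
  field
    ∇-assoc : ∇ ∘ (∇ ⊗₁ id) ≈ ∇ ∘ ((id ⊗₁ ∇) ∘ α)
    ∇-unitˡ : ∇ ∘ (u ⊗₁ id) ≈ ℓ
    ∇-unitʳ : ∇ ∘ (id ⊗₁ u) ≈ ρ
    Δ-coassoc : α ∘ ((Δ ⊗₁ id) ∘ Δ) ≈ (id ⊗₁ Δ) ∘ Δ
    Δ-counitˡ : ℓ ∘ ((ε ⊗₁ id) ∘ Δ) ≈ id
    Δ-counitʳ : ρ ∘ ((id ⊗₁ ε) ∘ Δ) ≈ id
    Δ-∇ : Δ ∘ ∇ ≈ (∇ ⊗₁ ∇) ∘ (τ ∘ (Δ ⊗₁ Δ))
    ε-∇ : ε ∘ ∇ ≈ ℓ ∘ (ε ⊗₁ ε)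
    Δ-u : Δ ∘ u ≈ (u ⊗₁ u) ∘ ℓ⁻¹
    ε-u : ε ∘ u ≈ id
    antipodeʳ : ∇ ∘ ((id ⊗₁ S) ∘ Δ) ≈ u ∘ ε
    antipodeˡ : ∇ ∘ ((S ⊗₁ id) ∘ Δ) ≈ u ∘ ε
    cocommutative : σ ∘ Δ ≈ Δ

module _ {o h e} (𝕏 : AdditiveSymmetricMonoidalCategory o h e)
         (M : MonoidalCoalgebraModality (AdditiveSymmetricMonoidalCategory.smc 𝕏)) where
  open AdditiveSymmetricMonoidalCategory 𝕏
  open MonoidalCoalgebraModality M

  !∇ : ∀ A → Hom (!₀ A ⊗₀ !₀ A) (!₀ A)
  !∇ A = !₁ ((ρ ∘ (ε ⊗₁ 𝖾)) + (ℓ ∘ (𝖾 ⊗₁ ε))) ∘ (m ∘ (δ {A} ⊗₁ δ {A}))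

  !u : ∀ A → Hom K (!₀ A)
  !u A = !₁ (0h {K} {A}) ∘ mK

  IsNaturalEndo : (∀ A → Hom (!₀ A) (!₀ A)) → Set (o ⊔ h ⊔ e)
  IsNaturalEndo S = ∀ {A B} (f : Hom A B) → !₁ f ∘ S A ≈ S B ∘ !₁ f

  HasNaturalHopfAntipode : Set (o ⊔ h ⊔ e)
  HasNaturalHopfAntipode =
    Σ (∀ A → Hom (!₀ A) (!₀ A)) λ S →
      IsNaturalEndo S ×
      (∀ A → IsCocommutativeHopfMonoid smc (!₀ A) (!∇ A) (!u A) (Δ {A}) (𝖾 {A}) (S A))

-- Composing with ε turns the convolution ∇ ∘ (f ⊗ g) ∘ Δ of two endomorphisms of !A
-- preserving e into the sum ε ∘ f + ε ∘ g.  An antipode S on !K preserves e, so ε ∘ S ∘ m_K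
-- is a negative of id_K, and tensoring with a negative of id_K negates any map.
-- Conversely, if n is a negative of id_A then !n commutes with δ, and for such
-- endomorphisms the convolution is !(ε ∘ f + ε ∘ g) ∘ δ; hence
-- ∇ ∘ (1 ⊗ !n) ∘ Δ = !(ε + n ∘ ε) ∘ δ = !0 ∘ δ = u ∘ e, so !n is an antipode, natural in A
-- because negatives are unique.
module Submission where

open import Data.Product using (_×_; _,_; proj₁; proj₂)
open import Relation.Binary using (Setoid; IsEquivalence)
open import Algebra.Structures using (IsCommutativeMonoid)
import Relation.Binary.Reasoning.Setoid as SetoidReasoning
open import Defs

module CategoryKit {o h e} (𝒞 : Category o h e) where
  open Category 𝒞

  hom-setoid : Obj → Obj → Setoid h e
  hom-setoid A B = record { isEquivalence = ≈-equiv {A} {B} }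

  module Equiv {A B} = IsEquivalence (≈-equiv {A} {B})
  open Equiv public using (refl; sym; trans)

  module HomReasoning {A B} = SetoidReasoning (hom-setoid A B)
  open HomReasoning public

  infixr 4 _⟩∘⟨_ refl⟩∘⟨_
  infixl 5 _⟩∘⟨refl

  _⟩∘⟨_ : ∀ {A B C} {f f′ : Hom B C} {g g′ : Hom A B} → f ≈ f′ → g ≈ g′ → f ∘ g ≈ f′ ∘ g′
  _⟩∘⟨_ = ∘-resp

  refl⟩∘⟨_ : ∀ {A B C} {f : Hom B C} {g g′ : Hom A B} → g ≈ g′ → f ∘ g ≈ f ∘ g′
  refl⟩∘⟨ p = refl ⟩∘⟨ p

  _⟩∘⟨refl : ∀ {A B C} {f f′ : Hom B C} {g : Hom A B} → f ≈ f′ → f ∘ g ≈ f′ ∘ g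
  p ⟩∘⟨refl = p ⟩∘⟨ refl

  sym-assoc : ∀ {A B C D} {f : Hom C D} {g : Hom B C} {k : Hom A B} →
              f ∘ (g ∘ k) ≈ (f ∘ g) ∘ k
  sym-assoc = sym assoc

  id-comm-sym : ∀ {A B} {f : Hom A B} → id ∘ f ≈ f ∘ id
  id-comm-sym = trans identityˡ (sym identityʳ)

  module _ {A B C D : Obj} {a : Hom C D} {b : Hom B C} {c : Hom B D} where
    pullˡ : ∀ {f : Hom A B} → a ∘ b ≈ c → a ∘ (b ∘ f) ≈ c ∘ f
    pullˡ p = trans sym-assoc (p ⟩∘⟨refl)

    pushˡ : ∀ {f : Hom A B} → c ≈ a ∘ b → c ∘ f ≈ a ∘ (b ∘ f)
    pushˡ p = trans (p ⟩∘⟨refl) assoc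

  extendʳ : ∀ {A B C C′ D} {a : Hom C D} {b : Hom B C} {c : Hom C′ D} {d : Hom B C′}
              {f : Hom A B} → a ∘ b ≈ c ∘ d → a ∘ (b ∘ f) ≈ c ∘ (d ∘ f)
  extendʳ p = trans (pullˡ p) assoc

  cancel-split-epi : ∀ {A B C} {f g : Hom B C} {i : Hom A B} {j : Hom B A} →
                     i ∘ j ≈ id → f ∘ i ≈ g ∘ i → f ≈ g
  cancel-split-epi {f = f} {g} {i} {j} ij≈id fi≈gi = begin
    f             ≈⟨ identityʳ ⟨
    f ∘ id        ≈⟨ refl⟩∘⟨ ij≈id ⟨
    f ∘ (i ∘ j)   ≈⟨ pullˡ fi≈gi ⟩
    (g ∘ i) ∘ j   ≈⟨ assoc ⟩
    g ∘ (i ∘ j)   ≈⟨ refl⟩∘⟨ ij≈id ⟩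
    g ∘ id        ≈⟨ identityʳ ⟩
    g             ∎

module MonoidalKit {o h e} (𝕊 : SymmetricMonoidalCategory o h e) where
  open SymmetricMonoidalCategory 𝕊
  open CategoryKit cat public

  infixr 5 _⟩⊗⟨_ refl⟩⊗⟨_
  infixl 6 _⟩⊗⟨refl

  _⟩⊗⟨_ : ∀ {A B C D} {f f′ : Hom A B} {g g′ : Hom C D} →
          f ≈ f′ → g ≈ g′ → f ⊗₁ g ≈ f′ ⊗₁ g′
  _⟩⊗⟨_ = ⊗-resp

  refl⟩⊗⟨_ : ∀ {A B C D} {f : Hom A B} {g g′ : Hom C D} → g ≈ g′ → f ⊗₁ g ≈ f ⊗₁ g′
  refl⟩⊗⟨ p = refl ⟩⊗⟨ p

  _⟩⊗⟨refl : ∀ {A B C D} {f f′ : Hom A B} {g : Hom C D} → f ≈ f′ → f ⊗₁ g ≈ f′ ⊗₁ g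
  p ⟩⊗⟨refl = p ⟩⊗⟨ refl

  serialize₁₂ : ∀ {A B C D} {f : Hom A B} {g : Hom C D} → f ⊗₁ g ≈ (f ⊗₁ id) ∘ (id ⊗₁ g)
  serialize₁₂ = trans (sym identityʳ ⟩⊗⟨ sym identityˡ) ⊗-∘

  serialize₂₁ : ∀ {A B C D} {f : Hom A B} {g : Hom C D} → f ⊗₁ g ≈ (id ⊗₁ g) ∘ (f ⊗₁ id)
  serialize₂₁ = trans (sym identityˡ ⟩⊗⟨ sym identityʳ) ⊗-∘

  ⊗-square : ∀ {A B C B′ D E F E′} {f : Hom B C} {a : Hom A B} {a′ : Hom B′ C} {f′ : Hom A B′}
               {g : Hom E F} {b : Hom D E} {b′ : Hom E′ F} {g′ : Hom D E′} →
             f ∘ a ≈ a′ ∘ f′ → g ∘ b ≈ b′ ∘ g′ → (f ⊗₁ g) ∘ (a ⊗₁ b) ≈ (a′ ⊗₁ b′) ∘ (f′ ⊗₁ g′)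
  ⊗-square p q = trans (sym ⊗-∘) (trans (p ⟩⊗⟨ q) ⊗-∘)

  α⁻¹-nat : ∀ {A A′ B B′ C C′} {f : Hom A A′} {g : Hom B B′} {k : Hom C C′} →
            α⁻¹ ∘ (f ⊗₁ (g ⊗₁ k)) ≈ ((f ⊗₁ g) ⊗₁ k) ∘ α⁻¹
  α⁻¹-nat {f = f} {g} {k} = cancel-split-epi α-isoʳ (begin
    (α⁻¹ ∘ (f ⊗₁ (g ⊗₁ k))) ∘ α   ≈⟨ assoc ⟩
    α⁻¹ ∘ ((f ⊗₁ (g ⊗₁ k)) ∘ α)   ≈⟨ refl⟩∘⟨ α-nat ⟨
    α⁻¹ ∘ (α ∘ ((f ⊗₁ g) ⊗₁ k))   ≈⟨ pullˡ α-isoˡ ⟩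
    id ∘ ((f ⊗₁ g) ⊗₁ k)          ≈⟨ id-comm-sym ⟩
    ((f ⊗₁ g) ⊗₁ k) ∘ id          ≈⟨ refl⟩∘⟨ α-isoˡ ⟨
    ((f ⊗₁ g) ⊗₁ k) ∘ (α⁻¹ ∘ α)   ≈⟨ sym-assoc ⟩
    (((f ⊗₁ g) ⊗₁ k) ∘ α⁻¹) ∘ α   ∎)

  τ-nat : ∀ {A A′ B B′ C C′ D D′} {a : Hom A A′} {b : Hom B B′} {c : Hom C C′} {d : Hom D D′} →
          τ ∘ ((a ⊗₁ b) ⊗₁ (c ⊗₁ d)) ≈ ((a ⊗₁ c) ⊗₁ (b ⊗₁ d)) ∘ τ
  τ-nat {a = a} {b} {c} {d} = begin
    (α⁻¹ ∘ (id ⊗₁ α) ∘ (id ⊗₁ (σ ⊗₁ id)) ∘ (id ⊗₁ α⁻¹) ∘ α) ∘ ((a ⊗₁ b) ⊗₁ (c ⊗₁ d))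
      ≈⟨ trans assoc (refl⟩∘⟨ trans assoc (refl⟩∘⟨ trans assoc (refl⟩∘⟨ assoc))) ⟩
    α⁻¹ ∘ (id ⊗₁ α) ∘ (id ⊗₁ (σ ⊗₁ id)) ∘ (id ⊗₁ α⁻¹) ∘ α ∘ ((a ⊗₁ b) ⊗₁ (c ⊗₁ d))
      ≈⟨ refl⟩∘⟨ refl⟩∘⟨ refl⟩∘⟨ refl⟩∘⟨ α-nat ⟩
    α⁻¹ ∘ (id ⊗₁ α) ∘ (id ⊗₁ (σ ⊗₁ id)) ∘ (id ⊗₁ α⁻¹) ∘ (a ⊗₁ (b ⊗₁ (c ⊗₁ d))) ∘ α
      ≈⟨ refl⟩∘⟨ refl⟩∘⟨ refl⟩∘⟨ extendʳ (⊗-square id-comm-sym α⁻¹-nat) ⟩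
    α⁻¹ ∘ (id ⊗₁ α) ∘ (id ⊗₁ (σ ⊗₁ id)) ∘ (a ⊗₁ ((b ⊗₁ c) ⊗₁ d)) ∘ (id ⊗₁ α⁻¹) ∘ α
      ≈⟨ refl⟩∘⟨ refl⟩∘⟨ extendʳ (⊗-square id-comm-sym (⊗-square σ-nat id-comm-sym)) ⟩
    α⁻¹ ∘ (id ⊗₁ α) ∘ (a ⊗₁ ((c ⊗₁ b) ⊗₁ d)) ∘ (id ⊗₁ (σ ⊗₁ id)) ∘ (id ⊗₁ α⁻¹) ∘ α
      ≈⟨ refl⟩∘⟨ extendʳ (⊗-square id-comm-sym α-nat) ⟩
    α⁻¹ ∘ (a ⊗₁ (c ⊗₁ (b ⊗₁ d))) ∘ (id ⊗₁ α) ∘ (id ⊗₁ (σ ⊗₁ id)) ∘ (id ⊗₁ α⁻¹) ∘ α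
      ≈⟨ extendʳ α⁻¹-nat ⟩
    ((a ⊗₁ c) ⊗₁ (b ⊗₁ d)) ∘ τ
      ∎

  K⊗-faithful : ∀ {A B} {f g : Hom A B} → id {K} ⊗₁ f ≈ id ⊗₁ g → f ≈ g
  K⊗-faithful {f = f} {g} p = cancel-split-epi ℓ-isoʳ (begin
    f ∘ ℓ          ≈⟨ ℓ-nat ⟩
    ℓ ∘ (id ⊗₁ f)  ≈⟨ refl⟩∘⟨ p ⟩
    ℓ ∘ (id ⊗₁ g)  ≈⟨ ℓ-nat ⟨
    g ∘ ℓ          ∎)

  -- Kelly's lemma: after tensoring with K it is the pentagon glued to two triangles.
  ℓ∘α≈ℓ⊗id : ∀ {A B} → ℓ {A ⊗₀ B} ∘ α {K} {A} {B} ≈ ℓ ⊗₁ id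
  ℓ∘α≈ℓ⊗id {A} {B} = K⊗-faithful (cancel-split-epi αα⁻¹≈id (begin
    (id ⊗₁ (ℓ ∘ α)) ∘ αα                     ≈⟨ trans (sym identityˡ ⟩⊗⟨refl) ⊗-∘ ⟩∘⟨refl ⟩
    ((id ⊗₁ ℓ) ∘ (id ⊗₁ α)) ∘ αα             ≈⟨ trans assoc (refl⟩∘⟨ pentagon) ⟩
    (id ⊗₁ ℓ) ∘ (α ∘ α)                      ≈⟨ pullˡ triangle ⟩
    (ρ ⊗₁ id) ∘ α                            ≈⟨ (refl⟩⊗⟨ sym ⊗-id) ⟩∘⟨refl ⟩
    (ρ ⊗₁ (id ⊗₁ id)) ∘ α                    ≈⟨ α-nat ⟨
    α ∘ ((ρ ⊗₁ id) ⊗₁ id)                    ≈⟨ refl⟩∘⟨ (triangle ⟩⊗⟨refl) ⟨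
    α ∘ (((id ⊗₁ ℓ) ∘ α) ⊗₁ id)              ≈⟨ refl⟩∘⟨ trans (refl⟩⊗⟨ sym identityˡ) ⊗-∘ ⟩
    α ∘ (((id ⊗₁ ℓ) ⊗₁ id) ∘ (α ⊗₁ id))      ≈⟨ extendʳ α-nat ⟩
    (id ⊗₁ (ℓ ⊗₁ id)) ∘ αα                   ∎))
    where
    αα : Hom (((K ⊗₀ K) ⊗₀ A) ⊗₀ B) (K ⊗₀ ((K ⊗₀ A) ⊗₀ B))
    αα = α {K} {K ⊗₀ A} {B} ∘ (α {K} {K} {A} ⊗₁ id {B})
    αα⁻¹≈id : αα ∘ ((α⁻¹ ⊗₁ id) ∘ α⁻¹) ≈ id
    αα⁻¹≈id = trans assoc (trans (refl⟩∘⟨ pullˡ (trans (sym ⊗-∘) (trans (α-isoʳ ⟩⊗⟨ identityˡ) ⊗-id)))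
                (trans (refl⟩∘⟨ identityˡ) α-isoʳ))

  ∘ℓ⊗id : ∀ {A B C} {x : Hom (A ⊗₀ B) C} → x ∘ (ℓ {A} ⊗₁ id {B}) ≈ ℓ ∘ ((id ⊗₁ x) ∘ α)
  ∘ℓ⊗id = trans (refl⟩∘⟨ sym ℓ∘α≈ℓ⊗id) (trans (pullˡ ℓ-nat) assoc)

  reassociate : ∀ {A B C D E V W X Z} {y : Hom (W ⊗₀ E) Z} {g : Hom (B ⊗₀ D) W}
                  {y′ : Hom (B ⊗₀ V) Z} {g′ : Hom (D ⊗₀ E) V}
                  {k : Hom A B} {l : Hom C D} {x : Hom X E} →
                y ∘ (g ⊗₁ id) ≈ y′ ∘ ((id ⊗₁ g′) ∘ α) →
                y ∘ ((g ∘ (k ⊗₁ l)) ⊗₁ x) ≈ (y′ ∘ (k ⊗₁ (g′ ∘ (l ⊗₁ x)))) ∘ α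
  reassociate {y = y} {g} {y′} {g′} {k} {l} {x} p = begin
    y ∘ ((g ∘ (k ⊗₁ l)) ⊗₁ x)                   ≈⟨ refl⟩∘⟨ trans (refl⟩⊗⟨ sym identityˡ) ⊗-∘ ⟩
    y ∘ ((g ⊗₁ id) ∘ ((k ⊗₁ l) ⊗₁ x))           ≈⟨ pullˡ p ⟩
    (y′ ∘ ((id ⊗₁ g′) ∘ α)) ∘ ((k ⊗₁ l) ⊗₁ x)   ≈⟨ trans assoc (refl⟩∘⟨ trans assoc (refl⟩∘⟨ α-nat)) ⟩
    y′ ∘ ((id ⊗₁ g′) ∘ ((k ⊗₁ (l ⊗₁ x)) ∘ α))   ≈⟨ refl⟩∘⟨ pullˡ (trans (sym ⊗-∘) (identityˡ ⟩⊗⟨refl)) ⟩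
    y′ ∘ ((k ⊗₁ (g′ ∘ (l ⊗₁ x))) ∘ α)           ≈⟨ sym-assoc ⟩
    (y′ ∘ (k ⊗₁ (g′ ∘ (l ⊗₁ x)))) ∘ α           ∎

module AdditiveKit {o h e} (𝕏 : AdditiveSymmetricMonoidalCategory o h e) where
  open AdditiveSymmetricMonoidalCategory 𝕏
  open MonoidalKit smc public

  module +-CM {A B} = IsCommutativeMonoid (+-isCommutativeMonoid {A} {B})
  open +-CM public using () renaming
    (∙-cong to +-cong; assoc to +-assoc; comm to +-comm; identityˡ to +-identityˡ; identityʳ to +-identityʳ)

  +-inverse-unique : ∀ {A B} {x y z : Hom A B} → y + x ≈ 0h → x + z ≈ 0h → y ≈ z
  +-inverse-unique {x = x} {y} {z} y+x≈0 x+z≈0 = begin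
    y              ≈⟨ +-identityʳ y ⟨
    y + 0h         ≈⟨ +-cong refl x+z≈0 ⟨
    y + (x + z)    ≈⟨ +-assoc y x z ⟨
    (y + x) + z    ≈⟨ +-cong y+x≈0 refl ⟩
    0h + z         ≈⟨ +-identityˡ z ⟩
    z              ∎

  negation-natural : ∀ {A B} {nA : Hom A A} {nB : Hom B B} (f : Hom A B) →
                     id + nA ≈ 0h → id + nB ≈ 0h → f ∘ nA ≈ nB ∘ f
  negation-natural {nA = nA} {nB} f idA+nA≈0 idB+nB≈0 = +-inverse-unique
    (trans (+-cong refl (sym identityʳ)) (trans (sym ∘-distribˡ)
      (trans (refl⟩∘⟨ trans (+-comm _ _) idA+nA≈0) ∘-zeroʳ)))
    (trans (+-cong (sym identityˡ) refl) (trans (sym ∘-distribʳ)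
      (trans (idB+nB≈0 ⟩∘⟨refl) ∘-zeroˡ)))

  negatives-from-unit : (n : Hom K K) → id + n ≈ 0h → AbelianGroupEnriched 𝕏
  negatives-from-unit n id+n≈0 f = ρ ∘ ((f ⊗₁ n) ∘ ρ⁻¹) , (begin
    f + ρ ∘ ((f ⊗₁ n) ∘ ρ⁻¹)                         ≈⟨ +-cong f≈ρ∘f⊗id∘ρ⁻¹ refl ⟩
    ρ ∘ ((f ⊗₁ id) ∘ ρ⁻¹) + ρ ∘ ((f ⊗₁ n) ∘ ρ⁻¹)     ≈⟨ sym ∘-distribˡ ⟩
    ρ ∘ ((f ⊗₁ id) ∘ ρ⁻¹ + (f ⊗₁ n) ∘ ρ⁻¹)           ≈⟨ refl⟩∘⟨ ∘-distribʳ ⟨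
    ρ ∘ (((f ⊗₁ id) + (f ⊗₁ n)) ∘ ρ⁻¹)               ≈⟨ refl⟩∘⟨ sym ⊗-distribˡ ⟩∘⟨refl ⟩
    ρ ∘ ((f ⊗₁ (id + n)) ∘ ρ⁻¹)                      ≈⟨ refl⟩∘⟨ trans (refl⟩⊗⟨ id+n≈0) ⊗-zeroʳ ⟩∘⟨refl ⟩
    ρ ∘ (0h ∘ ρ⁻¹)                                   ≈⟨ trans (refl⟩∘⟨ ∘-zeroˡ) ∘-zeroʳ ⟩
    0h                                               ∎)
    where
    f≈ρ∘f⊗id∘ρ⁻¹ : f ≈ ρ ∘ ((f ⊗₁ id) ∘ ρ⁻¹)
    f≈ρ∘f⊗id∘ρ⁻¹ = trans (sym identityʳ) (trans (refl⟩∘⟨ sym ρ-isoʳ) (trans sym-assoc (pushˡ ρ-nat)))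

module Modality {o h e} (𝕏 : AdditiveSymmetricMonoidalCategory o h e)
  (M : MonoidalCoalgebraModality (AdditiveSymmetricMonoidalCategory.smc 𝕏)) where
  open AdditiveSymmetricMonoidalCategory 𝕏
  open MonoidalCoalgebraModality M
  open AdditiveKit 𝕏

  ε-sum : ∀ A → Hom (!₀ A ⊗₀ !₀ A) A
  ε-sum A = ρ ∘ (ε ⊗₁ 𝖾) + ℓ ∘ (𝖾 ⊗₁ ε)

  mδ : ∀ {A B} → Hom (!₀ A ⊗₀ !₀ B) (!₀ (!₀ A ⊗₀ !₀ B))
  mδ = m ∘ (δ ⊗₁ δ)

  ∇ : ∀ A → Hom (!₀ A ⊗₀ !₀ A) (!₀ A)
  ∇ = !∇ 𝕏 M

  u : ∀ A → Hom K (!₀ A)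
  u = !u 𝕏 M

  Δ-counitʳ′ : ∀ {A B} {f : Hom (!₀ A) B} → ρ ∘ ((f ⊗₁ 𝖾) ∘ Δ) ≈ f
  Δ-counitʳ′ {f = f} = begin
    ρ ∘ ((f ⊗₁ 𝖾) ∘ Δ)                  ≈⟨ refl⟩∘⟨ pushˡ serialize₁₂ ⟩
    ρ ∘ ((f ⊗₁ id) ∘ ((id ⊗₁ 𝖾) ∘ Δ))   ≈⟨ pullˡ (sym ρ-nat) ⟩
    (f ∘ ρ) ∘ ((id ⊗₁ 𝖾) ∘ Δ)           ≈⟨ trans assoc (refl⟩∘⟨ Δ-counitʳ) ⟩
    f ∘ id                              ≈⟨ identityʳ ⟩
    f                                   ∎

  Δ-counitˡ′ : ∀ {A B} {f : Hom (!₀ A) B} → ℓ ∘ ((𝖾 ⊗₁ f) ∘ Δ) ≈ f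
  Δ-counitˡ′ {f = f} = begin
    ℓ ∘ ((𝖾 ⊗₁ f) ∘ Δ)                  ≈⟨ refl⟩∘⟨ pushˡ serialize₂₁ ⟩
    ℓ ∘ ((id ⊗₁ f) ∘ ((𝖾 ⊗₁ id) ∘ Δ))   ≈⟨ pullˡ (sym ℓ-nat) ⟩
    (f ∘ ℓ) ∘ ((𝖾 ⊗₁ id) ∘ Δ)           ≈⟨ trans assoc (refl⟩∘⟨ Δ-counitˡ) ⟩
    f ∘ id                              ≈⟨ identityʳ ⟩
    f                                   ∎

  !-∘˘ : ∀ {A B C} {f : Hom B C} {g : Hom A B} → !₁ f ∘ !₁ g ≈ !₁ (f ∘ g)
  !-∘˘ = sym !-∘

  δ-id : ∀ {A} → δ {A} ∘ id ≈ !₁ id ∘ δ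
  δ-id = trans identityʳ (trans (sym identityˡ) (sym !-id ⟩∘⟨refl))

  ε∘mδ : ∀ {A B} → ε ∘ mδ {A} {B} ≈ id
  ε∘mδ = trans (pullˡ ε-m) (trans (sym ⊗-∘) (trans (comonad-idˡ ⟩⊗⟨ comonad-idˡ) ⊗-id))

  𝖾∘mδ : ∀ {A B} → 𝖾 ∘ mδ {A} {B} ≈ ℓ ∘ (𝖾 ⊗₁ 𝖾)
  𝖾∘mδ = trans (pullˡ 𝖾-m) (trans assoc (refl⟩∘⟨ trans (sym ⊗-∘) (δ-𝖾 ⟩⊗⟨ δ-𝖾)))

  ε∘∇ : ∀ {A} → ε ∘ ∇ A ≈ ε-sum A
  ε∘∇ = trans (pullˡ (sym ε-nat)) (trans assoc (trans (refl⟩∘⟨ ε∘mδ) identityʳ))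

  𝖾∘∇ : ∀ {A} → 𝖾 ∘ ∇ A ≈ ℓ ∘ (𝖾 ⊗₁ 𝖾)
  𝖾∘∇ = trans (pullˡ 𝖾-nat) 𝖾∘mδ

  ε∘u : ∀ {A} → ε ∘ u A ≈ 0h
  ε∘u = trans (pullˡ (sym ε-nat)) (trans assoc ∘-zeroˡ)

  𝖾∘u : ∀ {A} → 𝖾 ∘ u A ≈ id
  𝖾∘u = trans (pullˡ 𝖾-nat) 𝖾-mK

  δ∘u : ∀ {A} → δ ∘ u A ≈ !₁ (u A) ∘ mK
  δ∘u = trans (pullˡ (sym δ-nat)) (trans assoc (trans (refl⟩∘⟨ δ-mK) (trans sym-assoc (!-∘˘ ⟩∘⟨refl))))

  !0∘δ : ∀ {A} → !₁ (0h { !₀ A } {A}) ∘ δ ≈ u A ∘ 𝖾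
  !0∘δ {A} = begin
    !₁ 0h ∘ δ              ≈⟨ !-resp ∘-zeroˡ ⟩∘⟨refl ⟨
    !₁ (0h ∘ 𝖾) ∘ δ        ≈⟨ pushˡ !-∘ ⟩
    !₁ 0h ∘ (!₁ 𝖾 ∘ δ)     ≈⟨ refl⟩∘⟨ !𝖾-δ ⟩
    !₁ 0h ∘ (mK ∘ 𝖾)       ≈⟨ sym-assoc ⟩
    u A ∘ 𝖾                ∎

  ε-sum-∘⊗ : ∀ {A X Y} {a : Hom X (!₀ A)} {b : Hom Y (!₀ A)} →
             ε-sum A ∘ (a ⊗₁ b) ≈ ρ ∘ ((ε ∘ a) ⊗₁ (𝖾 ∘ b)) + ℓ ∘ ((𝖾 ∘ a) ⊗₁ (ε ∘ b))
  ε-sum-∘⊗ = trans ∘-distribʳ (+-cong (trans assoc (refl⟩∘⟨ sym ⊗-∘)) (trans assoc (refl⟩∘⟨ sym ⊗-∘)))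

  ε-sum-convolution : ∀ {A} {f g : Hom (!₀ A) (!₀ A)} → 𝖾 ∘ f ≈ 𝖾 → 𝖾 ∘ g ≈ 𝖾 →
                      ε-sum A ∘ ((f ⊗₁ g) ∘ Δ) ≈ ε ∘ f + ε ∘ g
  ε-sum-convolution {A} {f} {g} 𝖾∘f≈𝖾 𝖾∘g≈𝖾 = begin
    ε-sum A ∘ ((f ⊗₁ g) ∘ Δ)                                           ≈⟨ pullˡ ε-sum-∘⊗ ⟩
    (ρ ∘ ((ε ∘ f) ⊗₁ (𝖾 ∘ g)) + ℓ ∘ ((𝖾 ∘ f) ⊗₁ (ε ∘ g))) ∘ Δ
      ≈⟨ +-cong (refl⟩∘⟨ (refl⟩⊗⟨ 𝖾∘g≈𝖾)) (refl⟩∘⟨ (𝖾∘f≈𝖾 ⟩⊗⟨refl)) ⟩∘⟨refl ⟩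
    (ρ ∘ ((ε ∘ f) ⊗₁ 𝖾) + ℓ ∘ (𝖾 ⊗₁ (ε ∘ g))) ∘ Δ                      ≈⟨ ∘-distribʳ ⟩
    (ρ ∘ ((ε ∘ f) ⊗₁ 𝖾)) ∘ Δ + (ℓ ∘ (𝖾 ⊗₁ (ε ∘ g))) ∘ Δ
      ≈⟨ +-cong (trans assoc Δ-counitʳ′) (trans assoc Δ-counitˡ′) ⟩
    ε ∘ f + ε ∘ g                                                      ∎

  ∇-∘⊗ : ∀ {A X Y X′ Y′} {a : Hom X (!₀ A)} {b : Hom Y (!₀ A)}
           {a′ : Hom X′ (!₀ A)} {a″ : Hom X (!₀ X′)} {b′ : Hom Y′ (!₀ A)} {b″ : Hom Y (!₀ Y′)} →
         δ ∘ a ≈ !₁ a′ ∘ a″ → δ ∘ b ≈ !₁ b′ ∘ b″ →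
         ∇ A ∘ (a ⊗₁ b) ≈ !₁ (ε-sum A ∘ (a′ ⊗₁ b′)) ∘ (m ∘ (a″ ⊗₁ b″))
  ∇-∘⊗ {A} {a = a} {b} {a′} {a″} {b′} {b″} δa δb = begin
    (!₁ (ε-sum A) ∘ (m ∘ (δ ⊗₁ δ))) ∘ (a ⊗₁ b)         ≈⟨ trans assoc (refl⟩∘⟨ assoc) ⟩
    !₁ (ε-sum A) ∘ (m ∘ ((δ ⊗₁ δ) ∘ (a ⊗₁ b)))         ≈⟨ refl⟩∘⟨ refl⟩∘⟨ ⊗-square δa δb ⟩
    !₁ (ε-sum A) ∘ (m ∘ ((!₁ a′ ⊗₁ !₁ b′) ∘ (a″ ⊗₁ b″)))  ≈⟨ refl⟩∘⟨ pullˡ (sym m-nat) ⟩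
    !₁ (ε-sum A) ∘ ((!₁ (a′ ⊗₁ b′) ∘ m) ∘ (a″ ⊗₁ b″))  ≈⟨ trans (refl⟩∘⟨ assoc) sym-assoc ⟩
    (!₁ (ε-sum A) ∘ !₁ (a′ ⊗₁ b′)) ∘ (m ∘ (a″ ⊗₁ b″))  ≈⟨ !-∘˘ ⟩∘⟨refl ⟩
    !₁ (ε-sum A ∘ (a′ ⊗₁ b′)) ∘ (m ∘ (a″ ⊗₁ b″))       ∎

  δ∘∇ : ∀ {A} → δ ∘ ∇ A ≈ !₁ (∇ A) ∘ mδ
  δ∘∇ {A} = begin
    δ ∘ (!₁ (ε-sum A) ∘ mδ)                                  ≈⟨ pullˡ (sym δ-nat) ⟩
    (!₁ (!₁ (ε-sum A)) ∘ δ) ∘ mδ                             ≈⟨ trans assoc (refl⟩∘⟨ pullˡ δ-m) ⟩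
    !₁ (!₁ (ε-sum A)) ∘ ((!₁ m ∘ mδ) ∘ (δ ⊗₁ δ))             ≈⟨ refl⟩∘⟨ trans assoc (refl⟩∘⟨ assoc) ⟩
    !₁ (!₁ (ε-sum A)) ∘ (!₁ m ∘ (m ∘ ((δ ⊗₁ δ) ∘ (δ ⊗₁ δ))))
      ≈⟨ refl⟩∘⟨ refl⟩∘⟨ refl⟩∘⟨ ⊗-square comonad-assoc comonad-assoc ⟩
    !₁ (!₁ (ε-sum A)) ∘ (!₁ m ∘ (m ∘ ((!₁ δ ⊗₁ !₁ δ) ∘ (δ ⊗₁ δ))))
      ≈⟨ refl⟩∘⟨ refl⟩∘⟨ trans (pullˡ (sym m-nat)) assoc ⟩
    !₁ (!₁ (ε-sum A)) ∘ (!₁ m ∘ (!₁ (δ ⊗₁ δ) ∘ mδ))          ≈⟨ trans (refl⟩∘⟨ sym-assoc) sym-assoc ⟩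
    (!₁ (!₁ (ε-sum A)) ∘ (!₁ m ∘ !₁ (δ ⊗₁ δ))) ∘ mδ          ≈⟨ trans (refl⟩∘⟨ !-∘˘) !-∘˘ ⟩∘⟨refl ⟩
    !₁ (∇ A) ∘ mδ                                            ∎

  ∇∘⊗∘Δ : ∀ {A} {f g : Hom (!₀ A) (!₀ A)} → δ ∘ f ≈ !₁ f ∘ δ → δ ∘ g ≈ !₁ g ∘ δ →
          ∇ A ∘ ((f ⊗₁ g) ∘ Δ) ≈ !₁ (ε-sum A ∘ ((f ⊗₁ g) ∘ Δ)) ∘ δ
  ∇∘⊗∘Δ {A} {f} {g} δf δg = begin
    ∇ A ∘ ((f ⊗₁ g) ∘ Δ)                     ≈⟨ pullˡ (∇-∘⊗ δf δg) ⟩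
    (!₁ (ε-sum A ∘ (f ⊗₁ g)) ∘ mδ) ∘ Δ       ≈⟨ trans assoc (refl⟩∘⟨ trans assoc (sym !Δ-δ)) ⟩
    !₁ (ε-sum A ∘ (f ⊗₁ g)) ∘ (!₁ Δ ∘ δ)     ≈⟨ trans sym-assoc (trans !-∘˘ (!-resp assoc) ⟩∘⟨refl) ⟩
    !₁ (ε-sum A ∘ ((f ⊗₁ g) ∘ Δ)) ∘ δ        ∎

  δ-commuting⇒𝖾-preserving : ∀ {A} {f : Hom (!₀ A) (!₀ A)} → δ ∘ f ≈ !₁ f ∘ δ → 𝖾 ∘ f ≈ 𝖾
  δ-commuting⇒𝖾-preserving {f = f} δf = begin
    𝖾 ∘ f              ≈⟨ δ-𝖾 ⟩∘⟨refl ⟨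
    (𝖾 ∘ δ) ∘ f        ≈⟨ trans assoc (refl⟩∘⟨ δf) ⟩
    𝖾 ∘ (!₁ f ∘ δ)     ≈⟨ pullˡ 𝖾-nat ⟩
    𝖾 ∘ δ              ≈⟨ δ-𝖾 ⟩
    𝖾                  ∎

  ∇-convolution : ∀ {A} {f g : Hom (!₀ A) (!₀ A)} → δ ∘ f ≈ !₁ f ∘ δ → δ ∘ g ≈ !₁ g ∘ δ →
                  ∇ A ∘ ((f ⊗₁ g) ∘ Δ) ≈ !₁ (ε ∘ f + ε ∘ g) ∘ δ
  ∇-convolution δf δg = trans (∇∘⊗∘Δ δf δg)
    (!-resp (ε-sum-convolution (δ-commuting⇒𝖾-preserving δf) (δ-commuting⇒𝖾-preserving δg)) ⟩∘⟨refl)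

  ∇-unitˡ : ∀ {A} → ∇ A ∘ (u A ⊗₁ id) ≈ ℓ
  ∇-unitˡ {A} = begin
    ∇ A ∘ (u A ⊗₁ id)                                  ≈⟨ ∇-∘⊗ δ∘u δ-id ⟩
    !₁ (ε-sum A ∘ (u A ⊗₁ id)) ∘ (m ∘ (mK ⊗₁ δ))       ≈⟨ !-resp ε-sum∘u⊗id ⟩∘⟨refl ⟩
    !₁ (ε ∘ ℓ) ∘ (m ∘ (mK ⊗₁ δ))                       ≈⟨ pushˡ !-∘ ⟩
    !₁ ε ∘ (!₁ ℓ ∘ (m ∘ (mK ⊗₁ δ)))                    ≈⟨ refl⟩∘⟨ refl⟩∘⟨ refl⟩∘⟨ serialize₁₂ ⟩
    !₁ ε ∘ (!₁ ℓ ∘ (m ∘ ((mK ⊗₁ id) ∘ (id ⊗₁ δ))))     ≈⟨ refl⟩∘⟨ trans (refl⟩∘⟨ sym-assoc) (pullˡ m-unitˡ) ⟩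
    !₁ ε ∘ (ℓ ∘ (id ⊗₁ δ))                             ≈⟨ refl⟩∘⟨ ℓ-nat ⟨
    !₁ ε ∘ (δ ∘ ℓ)                                     ≈⟨ pullˡ comonad-idʳ ⟩
    id ∘ ℓ                                             ≈⟨ identityˡ ⟩
    ℓ                                                  ∎
    where
    ε-sum∘u⊗id : ε-sum A ∘ (u A ⊗₁ id) ≈ ε ∘ ℓ
    ε-sum∘u⊗id = trans ε-sum-∘⊗ (trans
      (+-cong (trans (refl⟩∘⟨ trans (ε∘u ⟩⊗⟨refl) ⊗-zeroˡ) ∘-zeroʳ) (refl⟩∘⟨ (𝖾∘u ⟩⊗⟨ identityʳ)))
      (trans (+-identityˡ _) (sym ℓ-nat)))

  ∇-unitʳ : ∀ {A} → ∇ A ∘ (id ⊗₁ u A) ≈ ρ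
  ∇-unitʳ {A} = begin
    ∇ A ∘ (id ⊗₁ u A)                                  ≈⟨ ∇-∘⊗ δ-id δ∘u ⟩
    !₁ (ε-sum A ∘ (id ⊗₁ u A)) ∘ (m ∘ (δ ⊗₁ mK))       ≈⟨ !-resp ε-sum∘id⊗u ⟩∘⟨refl ⟩
    !₁ (ε ∘ ρ) ∘ (m ∘ (δ ⊗₁ mK))                       ≈⟨ pushˡ !-∘ ⟩
    !₁ ε ∘ (!₁ ρ ∘ (m ∘ (δ ⊗₁ mK)))                    ≈⟨ refl⟩∘⟨ refl⟩∘⟨ refl⟩∘⟨ serialize₂₁ ⟩
    !₁ ε ∘ (!₁ ρ ∘ (m ∘ ((id ⊗₁ mK) ∘ (δ ⊗₁ id))))     ≈⟨ refl⟩∘⟨ trans (refl⟩∘⟨ sym-assoc) (pullˡ m-unitʳ) ⟩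
    !₁ ε ∘ (ρ ∘ (δ ⊗₁ id))                             ≈⟨ refl⟩∘⟨ ρ-nat ⟨
    !₁ ε ∘ (δ ∘ ρ)                                     ≈⟨ pullˡ comonad-idʳ ⟩
    id ∘ ρ                                             ≈⟨ identityˡ ⟩
    ρ                                                  ∎
    where
    ε-sum∘id⊗u : ε-sum A ∘ (id ⊗₁ u A) ≈ ε ∘ ρ
    ε-sum∘id⊗u = trans ε-sum-∘⊗ (trans
      (+-cong (refl⟩∘⟨ (identityʳ ⟩⊗⟨ 𝖾∘u)) (trans (refl⟩∘⟨ trans (refl⟩⊗⟨ ε∘u) ⊗-zeroʳ) ∘-zeroʳ))
      (trans (+-identityʳ _) (sym ρ-nat)))

  ε-sum-assoc : ∀ {A} → ε-sum A ∘ (∇ A ⊗₁ id) ≈ (ε-sum A ∘ (id ⊗₁ ∇ A)) ∘ α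
  ε-sum-assoc {A} = begin
    ε-sum A ∘ (∇ A ⊗₁ id)
      ≈⟨ trans ε-sum-∘⊗ (+-cong (refl⟩∘⟨ (ε∘∇ ⟩⊗⟨ identityʳ)) (refl⟩∘⟨ (𝖾∘∇ ⟩⊗⟨ identityʳ))) ⟩
    ρ ∘ (ε-sum A ⊗₁ 𝖾) + ℓ ∘ ((ℓ ∘ (𝖾 ⊗₁ 𝖾)) ⊗₁ ε)
      ≈⟨ +-cong (trans (refl⟩∘⟨ ⊗-distribʳ) ∘-distribˡ) refl ⟩
    (ρ ∘ ((ρ ∘ (ε ⊗₁ 𝖾)) ⊗₁ 𝖾) + ρ ∘ ((ℓ ∘ (𝖾 ⊗₁ ε)) ⊗₁ 𝖾)) + ℓ ∘ ((ℓ ∘ (𝖾 ⊗₁ 𝖾)) ⊗₁ ε)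
      ≈⟨ +-cong (+-cong (reassociate (refl⟩∘⟨ sym triangle)) (reassociate ∘ℓ⊗id)) (reassociate ∘ℓ⊗id) ⟩
    ((ρ ∘ (ε ⊗₁ (ℓ ∘ (𝖾 ⊗₁ 𝖾)))) ∘ α + (ℓ ∘ (𝖾 ⊗₁ (ρ ∘ (ε ⊗₁ 𝖾)))) ∘ α) + (ℓ ∘ (𝖾 ⊗₁ (ℓ ∘ (𝖾 ⊗₁ ε)))) ∘ α
      ≈⟨ trans (+-cong (sym ∘-distribʳ) refl) (sym ∘-distribʳ) ⟩
    ((ρ ∘ (ε ⊗₁ (ℓ ∘ (𝖾 ⊗₁ 𝖾))) + ℓ ∘ (𝖾 ⊗₁ (ρ ∘ (ε ⊗₁ 𝖾)))) + ℓ ∘ (𝖾 ⊗₁ (ℓ ∘ (𝖾 ⊗₁ ε)))) ∘ α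
      ≈⟨ trans (+-assoc _ _ _) (+-cong refl (sym (trans (refl⟩∘⟨ ⊗-distribˡ) ∘-distribˡ))) ⟩∘⟨refl ⟩
    (ρ ∘ (ε ⊗₁ (ℓ ∘ (𝖾 ⊗₁ 𝖾))) + ℓ ∘ (𝖾 ⊗₁ ε-sum A)) ∘ α
      ≈⟨ trans ε-sum-∘⊗ (+-cong (refl⟩∘⟨ (identityʳ ⟩⊗⟨ 𝖾∘∇)) (refl⟩∘⟨ (identityʳ ⟩⊗⟨ ε∘∇))) ⟩∘⟨refl ⟨
    (ε-sum A ∘ (id ⊗₁ ∇ A)) ∘ α
      ∎

  mδ-assoc : ∀ {A B C} → (m ∘ (δ {A} ⊗₁ mδ {B} {C})) ∘ α ≈ !₁ α ∘ (m ∘ (mδ ⊗₁ δ))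
  mδ-assoc = begin
    (m ∘ (δ ⊗₁ (m ∘ (δ ⊗₁ δ)))) ∘ α                ≈⟨ (refl⟩∘⟨ trans (sym identityˡ ⟩⊗⟨refl) ⊗-∘) ⟩∘⟨refl ⟩
    (m ∘ ((id ⊗₁ m) ∘ (δ ⊗₁ (δ ⊗₁ δ)))) ∘ α        ≈⟨ trans assoc (refl⟩∘⟨ trans assoc (refl⟩∘⟨ sym α-nat)) ⟩
    m ∘ ((id ⊗₁ m) ∘ (α ∘ ((δ ⊗₁ δ) ⊗₁ δ)))        ≈⟨ trans (refl⟩∘⟨ sym-assoc) sym-assoc ⟩
    (m ∘ ((id ⊗₁ m) ∘ α)) ∘ ((δ ⊗₁ δ) ⊗₁ δ)        ≈⟨ m-assoc ⟩∘⟨refl ⟩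
    (!₁ α ∘ (m ∘ (m ⊗₁ id))) ∘ ((δ ⊗₁ δ) ⊗₁ δ)     ≈⟨ trans assoc (refl⟩∘⟨ assoc) ⟩
    !₁ α ∘ (m ∘ ((m ⊗₁ id) ∘ ((δ ⊗₁ δ) ⊗₁ δ)))     ≈⟨ refl⟩∘⟨ refl⟩∘⟨ trans (sym ⊗-∘) (refl⟩⊗⟨ identityˡ) ⟩
    !₁ α ∘ (m ∘ (mδ ⊗₁ δ))                         ∎

  ∇-assoc : ∀ {A} → ∇ A ∘ (∇ A ⊗₁ id) ≈ ∇ A ∘ ((id ⊗₁ ∇ A) ∘ α)
  ∇-assoc {A} = begin
    ∇ A ∘ (∇ A ⊗₁ id)                                      ≈⟨ ∇-∘⊗ δ∘∇ δ-id ⟩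
    !₁ (ε-sum A ∘ (∇ A ⊗₁ id)) ∘ (m ∘ (mδ ⊗₁ δ))           ≈⟨ !-resp ε-sum-assoc ⟩∘⟨refl ⟩
    !₁ ((ε-sum A ∘ (id ⊗₁ ∇ A)) ∘ α) ∘ (m ∘ (mδ ⊗₁ δ))     ≈⟨ pushˡ !-∘ ⟩
    !₁ (ε-sum A ∘ (id ⊗₁ ∇ A)) ∘ (!₁ α ∘ (m ∘ (mδ ⊗₁ δ)))  ≈⟨ refl⟩∘⟨ mδ-assoc ⟨
    !₁ (ε-sum A ∘ (id ⊗₁ ∇ A)) ∘ ((m ∘ (δ ⊗₁ mδ)) ∘ α)     ≈⟨ sym-assoc ⟩
    (!₁ (ε-sum A ∘ (id ⊗₁ ∇ A)) ∘ (m ∘ (δ ⊗₁ mδ))) ∘ α     ≈⟨ ∇-∘⊗ δ-id δ∘∇ ⟩∘⟨refl ⟨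
    (∇ A ∘ (id ⊗₁ ∇ A)) ∘ α                                ≈⟨ assoc ⟩
    ∇ A ∘ ((id ⊗₁ ∇ A) ∘ α)                                ∎

  Δ-∇ : ∀ {A} → Δ ∘ ∇ A ≈ (∇ A ⊗₁ ∇ A) ∘ (τ ∘ (Δ ⊗₁ Δ))
  Δ-∇ {A} = begin
    Δ ∘ (!₁ (ε-sum A) ∘ mδ)                                      ≈⟨ pullˡ (sym Δ-nat) ⟩
    ((!₁ (ε-sum A) ⊗₁ !₁ (ε-sum A)) ∘ Δ) ∘ mδ                    ≈⟨ trans assoc (refl⟩∘⟨ pullˡ Δ-m) ⟩
    (!₁ (ε-sum A) ⊗₁ !₁ (ε-sum A)) ∘ (((m ⊗₁ m) ∘ (τ ∘ (Δ ⊗₁ Δ))) ∘ (δ ⊗₁ δ))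
      ≈⟨ refl⟩∘⟨ trans assoc (refl⟩∘⟨ trans assoc (refl⟩∘⟨ ⊗-square δ-Δ δ-Δ)) ⟩
    (!₁ (ε-sum A) ⊗₁ !₁ (ε-sum A)) ∘ ((m ⊗₁ m) ∘ (τ ∘ (((δ ⊗₁ δ) ⊗₁ (δ ⊗₁ δ)) ∘ (Δ ⊗₁ Δ))))
      ≈⟨ refl⟩∘⟨ refl⟩∘⟨ extendʳ τ-nat ⟩
    (!₁ (ε-sum A) ⊗₁ !₁ (ε-sum A)) ∘ ((m ⊗₁ m) ∘ (((δ ⊗₁ δ) ⊗₁ (δ ⊗₁ δ)) ∘ (τ ∘ (Δ ⊗₁ Δ))))
      ≈⟨ refl⟩∘⟨ pullˡ (sym ⊗-∘) ⟩
    (!₁ (ε-sum A) ⊗₁ !₁ (ε-sum A)) ∘ ((mδ ⊗₁ mδ) ∘ (τ ∘ (Δ ⊗₁ Δ)))  ≈⟨ pullˡ (sym ⊗-∘) ⟩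
    (∇ A ⊗₁ ∇ A) ∘ (τ ∘ (Δ ⊗₁ Δ))                                ∎

  Δ-u : ∀ {A} → Δ ∘ u A ≈ (u A ⊗₁ u A) ∘ ℓ⁻¹
  Δ-u = trans (pullˡ (sym Δ-nat)) (trans assoc (trans (refl⟩∘⟨ Δ-mK) (trans sym-assoc (sym ⊗-∘ ⟩∘⟨refl))))

  module _ {A} {n : Hom A A} (id+n≈0 : id + n ≈ 0h) where
    ε+ε∘!n≈0 : ε ∘ id + ε ∘ !₁ n ≈ 0h
    ε+ε∘!n≈0 = begin
      ε ∘ id + ε ∘ !₁ n    ≈⟨ +-cong (sym id-comm-sym) (sym ε-nat) ⟩
      id ∘ ε + n ∘ ε       ≈⟨ ∘-distribʳ ⟨
      (id + n) ∘ ε         ≈⟨ id+n≈0 ⟩∘⟨refl ⟩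
      0h ∘ ε               ≈⟨ ∘-zeroˡ ⟩
      0h                   ∎

    !-antipodeʳ : ∇ A ∘ ((id ⊗₁ !₁ n) ∘ Δ) ≈ u A ∘ 𝖾
    !-antipodeʳ = trans (∇-convolution δ-id (sym δ-nat)) (trans (!-resp ε+ε∘!n≈0 ⟩∘⟨refl) !0∘δ)

    !-antipodeˡ : ∇ A ∘ ((!₁ n ⊗₁ id) ∘ Δ) ≈ u A ∘ 𝖾
    !-antipodeˡ = trans (∇-convolution (sym δ-nat) δ-id)
      (trans (!-resp (trans (+-comm _ _) ε+ε∘!n≈0) ⟩∘⟨refl) !0∘δ)

  module _ {A} {S : Hom (!₀ A) (!₀ A)}
           (hopf : IsCocommutativeHopfMonoid smc (!₀ A) (∇ A) (u A) Δ 𝖾 S) where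
    open IsCocommutativeHopfMonoid hopf using (antipodeʳ)

    𝖾∘antipode : 𝖾 ∘ S ≈ 𝖾
    𝖾∘antipode = begin
      𝖾 ∘ S                               ≈⟨ Δ-counitˡ′ ⟨
      ℓ ∘ ((𝖾 ⊗₁ (𝖾 ∘ S)) ∘ Δ)            ≈⟨ refl⟩∘⟨ pushˡ (trans (sym identityʳ ⟩⊗⟨refl) ⊗-∘) ⟩
      ℓ ∘ ((𝖾 ⊗₁ 𝖾) ∘ ((id ⊗₁ S) ∘ Δ))    ≈⟨ pullˡ (sym 𝖾∘∇) ⟩
      (𝖾 ∘ ∇ A) ∘ ((id ⊗₁ S) ∘ Δ)         ≈⟨ trans assoc (refl⟩∘⟨ antipodeʳ) ⟩
      𝖾 ∘ (u A ∘ 𝖾)                       ≈⟨ pullˡ 𝖾∘u ⟩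
      id ∘ 𝖾                              ≈⟨ identityˡ ⟩
      𝖾                                   ∎

    ε+ε∘antipode≈0 : ε + ε ∘ S ≈ 0h
    ε+ε∘antipode≈0 = begin
      ε + ε ∘ S                           ≈⟨ +-cong identityʳ refl ⟨
      ε ∘ id + ε ∘ S                      ≈⟨ ε-sum-convolution identityʳ 𝖾∘antipode ⟨
      ε-sum A ∘ ((id ⊗₁ S) ∘ Δ)           ≈⟨ pullˡ ε∘∇ ⟨
      ε ∘ (∇ A ∘ ((id ⊗₁ S) ∘ Δ))         ≈⟨ refl⟩∘⟨ antipodeʳ ⟩
      ε ∘ (u A ∘ 𝖾)                       ≈⟨ pullˡ ε∘u ⟩
      0h ∘ 𝖾                              ≈⟨ ∘-zeroˡ ⟩
      0h                                  ∎

  hopf⇒negatives : HasNaturalHopfAntipode 𝕏 M → AbelianGroupEnriched 𝕏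
  hopf⇒negatives (S , _ , hopf) = negatives-from-unit (ε ∘ (S K ∘ mK)) (begin
    id + ε ∘ (S K ∘ mK)        ≈⟨ +-cong (sym ε-mK) sym-assoc ⟩
    ε ∘ mK + (ε ∘ S K) ∘ mK    ≈⟨ ∘-distribʳ ⟨
    (ε + ε ∘ S K) ∘ mK         ≈⟨ ε+ε∘antipode≈0 (hopf K) ⟩∘⟨refl ⟩
    0h ∘ mK                    ≈⟨ ∘-zeroˡ ⟩
    0h                         ∎)

  negatives⇒hopf : AbelianGroupEnriched 𝕏 → HasNaturalHopfAntipode 𝕏 M
  negatives⇒hopf neg = antipode , antipode-natural , hopf
    where
    negate : ∀ A → Hom A A
    negate A = proj₁ (neg (id {A}))

    id+negate≈0 : ∀ {A} → id + negate A ≈ 0h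
    id+negate≈0 = proj₂ (neg id)

    antipode : ∀ A → Hom (!₀ A) (!₀ A)
    antipode A = !₁ (negate A)

    antipode-natural : IsNaturalEndo 𝕏 M antipode
    antipode-natural f = trans !-∘˘ (trans (!-resp (negation-natural f id+negate≈0 id+negate≈0)) !-∘)

    hopf : ∀ A → IsCocommutativeHopfMonoid smc (!₀ A) (∇ A) (u A) Δ 𝖾 (antipode A)
    hopf A = record
      { ∇-assoc       = ∇-assoc
      ; ∇-unitˡ       = ∇-unitˡ
      ; ∇-unitʳ       = ∇-unitʳ
      ; Δ-coassoc     = Δ-coassoc
      ; Δ-counitˡ     = Δ-counitˡ
      ; Δ-counitʳ     = Δ-counitʳ
      ; Δ-∇           = Δ-∇
      ; ε-∇           = 𝖾∘∇
      ; Δ-u           = Δ-u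
      ; ε-u           = 𝖾∘u
      ; antipodeʳ     = !-antipodeʳ id+negate≈0
      ; antipodeˡ     = !-antipodeˡ id+negate≈0
      ; cocommutative = Δ-cocomm
      }

proposition7p6 : ∀ {o h e} (𝕏 : AdditiveSymmetricMonoidalCategory o h e)
                   (M : MonoidalCoalgebraModality (AdditiveSymmetricMonoidalCategory.smc 𝕏)) →
                   (HasNaturalHopfAntipode 𝕏 M → AbelianGroupEnriched 𝕏) ×
                   (AbelianGroupEnriched 𝕏 → HasNaturalHopfAntipode 𝕏 M)
proposition7p6 𝕏 M = hopf⇒negatives , negatives⇒hopf
  where open Modality 𝕏 M
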